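{- Let $\Delta$ be a labeled hypergraph on $[d]$ (with $n=4$) having only edges of Type $2$ and Type $3$, let $e_1,e_2\in\Delta$, and let $N$ be a loopless matroid on $[d]$ of rank at most $4$ with $N\preceq\Delta$, with rank function $\mathrm{rank}$. Then: (i) if $e_1,e_2\in\Delta_3$, then $\mathrm{rank}(e_1\cap e_2)\le2$ or $\mathrm{rank}(e_1\cup e_2)\le3$; (ii) if $e_1\in\Delta_3$ and $e_2\in\Delta_2$, then $\mathrm{rank}(e_1\cap e_2)\le1$ or $\mathrm{rank}(e_1\cup e_2)\le3$; (iii) if $e_1,e_2\in\Delta_2$, then $\mathrm{rank}(e_1\cap e_2)\le1$ or $\mathrm{rank}(e_1\cup e_2)\le2$; (iv) if $e_1,e_2\in\Delta_2$ and $e_1\cap e_2\ne\emptyset$, then $\mathrm{rank}(e_1\cup e_2)\le3$.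
   Context: A labeled hypergraph $\Delta$ on $[d]$ (with respect to $n=4$) is a collection of subsets (edges) each labeled with a Type $i\in\{0,1,2,3\}$, such that no two edges of the same type are properly contained in one another and each edge of Type $i$ has at least $i+1$ elements; $\Delta_i$ is the set of edges of Type $i$. $N\preceq\Delta$ means $\mathrm{rank}_N(e)\le i$ for every $e\in\Delta_i$. -}

module Defs where

open import Data.Nat using (ℕ; suc; _≤_; _+_)
open import Data.Fin using (Fin; zero; suc; toℕ)
open import Data.Fin.Subset using (Subset; _⊆_; _⊂_; _∩_; _∪_; ∣_∣; ⁅_⁆; ⊤)
open import Data.Product using (_×_)
open import Relation.Nullary using (¬_)
open import Relation.Binary.PropositionalEquality using (_≡_)

record Matroid (d : ℕ) : Set where
  field
    rank        : Subset d → ℕ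
    rank-bound  : ∀ X → rank X ≤ ∣ X ∣
    rank-mono   : ∀ X Y → X ⊆ Y → rank X ≤ rank Y
    rank-submod : ∀ X Y → rank (X ∩ Y) + rank (X ∪ Y) ≤ rank X + rank Y
open Matroid public

Loopless : ∀ {d} → Matroid d → Set
Loopless {d} N = ∀ (i : Fin d) → rank N ⁅ i ⁆ ≡ 1

matroidRank : ∀ {d} → Matroid d → ℕ
matroidRank N = rank N ⊤

type0 type1 type2 type3 : Fin 4
type0 = zero
type1 = suc zero
type2 = suc (suc zero)
type3 = suc (suc (suc zero))

-- A labeled hypergraph on [d] w.r.t. n = 4: for each type i, the
-- (finite, since Subset d is finite) set Δ_i of edges of type i.
record LabeledHypergraph (d : ℕ) : Set₁ where
  field
    edges     : Fin 4 → Subset d → Set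
    antichain : ∀ i e f → edges i e → edges i f → ¬ (e ⊂ f)
    edge-size : ∀ i e → edges i e → suc (toℕ i) ≤ ∣ e ∣
open LabeledHypergraph public

OnlyTypes23 : ∀ {d} → LabeledHypergraph d → Set
OnlyTypes23 Δ = ∀ e → ¬ edges Δ type0 e × ¬ edges Δ type1 e

_⪯_ : ∀ {d} → Matroid d → LabeledHypergraph d → Set
N ⪯ Δ = ∀ i e → edges Δ i e → rank N e ≤ toℕ i

{-# OPTIONS --safe #-}
-- All four parts come from one inequality: by submodularity and N ⪯ Δ,
-- rank (e₁ ∩ e₂) + rank (e₁ ∪ e₂) ≤ i + j for e₁ ∈ Δ_i and e₂ ∈ Δ_j, so if the
-- intersection is too large the union must be small. For (iv), looplessness
-- makes a nonempty intersection have positive rank.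
module Submission where

open import Defs
open import Data.Nat using (ℕ; _≤_; _<_; _+_; suc; _≤?_)
open import Data.Nat.Properties using (≤-trans; ≤-reflexive; +-mono-≤; +-monoˡ-≤; +-cancelˡ-≤; +-suc; ≰⇒>; <⇒≱)
open import Data.Fin using (toℕ)
open import Data.Fin.Subset using (Subset; _∩_; _∪_; Nonempty; _∈_; ⁅_⁆; _⊆_)
open import Data.Fin.Subset.Properties using (x∈⁅y⁆⇒x≡y)
open import Data.Product using (_×_; _,_)
open import Data.Sum using (_⊎_; inj₁; inj₂; [_,_]′)
open import Function using (id)
open import Relation.Nullary using (yes; no; contradiction)
open import Relation.Binary.PropositionalEquality using (subst; sym)

m+n≤o+1+p⇒m≤o⊎n≤p : ∀ m n o p → m + n ≤ o + suc p → m ≤ o ⊎ n ≤ p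
m+n≤o+1+p⇒m≤o⊎n≤p m n o p m+n≤o+1+p with m ≤? o
... | yes m≤o = inj₁ m≤o
... | no  m≰o = inj₂ (+-cancelˡ-≤ (suc o) n p
  (≤-trans (+-monoˡ-≤ n (≰⇒> m≰o)) (≤-trans m+n≤o+1+p (≤-reflexive (+-suc o p)))))

x∈X⇒⁅x⁆⊆X : ∀ {d x} {X : Subset d} → x ∈ X → ⁅ x ⁆ ⊆ X
x∈X⇒⁅x⁆⊆X {x = x} {X} x∈X y∈⁅x⁆ = subst (_∈ X) (sym (x∈⁅y⁆⇒x≡y x y∈⁅x⁆)) x∈X

module _ {d : ℕ} (N : Matroid d) where

  loopless⇒nonempty⇒0<rank : Loopless N → ∀ {X} → Nonempty X → 0 < rank N X
  loopless⇒nonempty⇒0<rank loopless {X} (x , x∈X) =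
    subst (_≤ rank N X) (loopless x) (rank-mono N ⁅ x ⁆ X (x∈X⇒⁅x⁆⊆X x∈X))

  ⪯⇒rank-∩+rank-∪≤types : ∀ Δ → N ⪯ Δ → ∀ {i j e₁ e₂} → edges Δ i e₁ → edges Δ j e₂
    → rank N (e₁ ∩ e₂) + rank N (e₁ ∪ e₂) ≤ toℕ i + toℕ j
  ⪯⇒rank-∩+rank-∪≤types _ N⪯Δ {i} {j} {e₁} {e₂} e₁∈Δᵢ e₂∈Δⱼ =
    ≤-trans (rank-submod N e₁ e₂) (+-mono-≤ (N⪯Δ i e₁ e₁∈Δᵢ) (N⪯Δ j e₂ e₂∈Δⱼ))

lemma5p1 : (d : ℕ) (Δ : LabeledHypergraph d) (N : Matroid d)
    → OnlyTypes23 Δ → Loopless N → matroidRank N ≤ 4 → N ⪯ Δ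
    → (e₁ e₂ : Subset d)
    → ((edges Δ type3 e₁ → edges Δ type3 e₂ → rank N (e₁ ∩ e₂) ≤ 2 ⊎ rank N (e₁ ∪ e₂) ≤ 3)
      × (edges Δ type3 e₁ → edges Δ type2 e₂ → rank N (e₁ ∩ e₂) ≤ 1 ⊎ rank N (e₁ ∪ e₂) ≤ 3)
      × (edges Δ type2 e₁ → edges Δ type2 e₂ → rank N (e₁ ∩ e₂) ≤ 1 ⊎ rank N (e₁ ∪ e₂) ≤ 2)
      × (edges Δ type2 e₁ → edges Δ type2 e₂ → Nonempty (e₁ ∩ e₂) → rank N (e₁ ∪ e₂) ≤ 3))
lemma5p1 d Δ N _ loopless _ N⪯Δ e₁ e₂ =
    (λ e₁∈Δ₃ e₂∈Δ₃ → split 2 3 (bound e₁∈Δ₃ e₂∈Δ₃))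
  , (λ e₁∈Δ₃ e₂∈Δ₂ → split 1 3 (bound e₁∈Δ₃ e₂∈Δ₂))
  , (λ e₁∈Δ₂ e₂∈Δ₂ → split 1 2 (bound e₁∈Δ₂ e₂∈Δ₂))
  , λ e₁∈Δ₂ e₂∈Δ₂ e₁∩e₂≠∅ →
      [ (λ rank∩≤0 → contradiction rank∩≤0 (<⇒≱ (loopless⇒nonempty⇒0<rank N loopless e₁∩e₂≠∅)))
      , id
      ]′ (split 0 3 (bound e₁∈Δ₂ e₂∈Δ₂))
  where
  bound : ∀ {i j} → edges Δ i e₁ → edges Δ j e₂
    → rank N (e₁ ∩ e₂) + rank N (e₁ ∪ e₂) ≤ toℕ i + toℕ j
  bound = ⪯⇒rank-∩+rank-∪≤types N Δ N⪯Δ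
  split : ∀ o p → rank N (e₁ ∩ e₂) + rank N (e₁ ∪ e₂) ≤ o + suc p
    → rank N (e₁ ∩ e₂) ≤ o ⊎ rank N (e₁ ∪ e₂) ≤ p
  split = m+n≤o+1+p⇒m≤o⊎n≤p (rank N (e₁ ∩ e₂)) (rank N (e₁ ∪ e₂))
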